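{- Let $S,A_1,A_2$ be labeled switchboards such that $A_1$ and $A_2$ both extend $S$ (as substructures), and $A_i=S\cup\{a_i\}$ for $i=1,2$, where $a_1,a_2$ are two distinct elements not in $S$. Let $M=A_1\cup A_2=S\cup\{a_1,a_2\}$. Then $M$ can be made into a labeled switchboard extending both $A_1$ and $A_2$ in which $a_1$ and $a_2$ are freely amalgamated over $S$.
   Context: For a set $M$, $[M]^2$ is the set of 2-element subsets of $M$. A switchboard is a set $M$ with a strict partial order $<$ on $[M]^2$ such that for distinct $x,y,z\in M$, $\{x,y\}$ and $\{x,z\}$ are incomparable. A labeled switchboard is $(M,<,\uparrow,\downarrow)$ where $(M,<)$ is a switchboard, $\uparrow,\downarrow$ are binary relations between $M$ and $[M]^2$, and: (Trichotomy) for every $a\in M$, $\{b,c\}\in[M]^2$ exactly one of $a\uparrow\{b,c\}$, $a\in\{b,c\}$, $a\downarrow\{b,c\}$ holds; (Upward) $a\uparrow\{b,c\}<\{b',c'\}$ implies $a\uparrow\{b',c'\}$; (Downward) $a\downarrow\{b,c\}>\{b',c'\}$ implies $a\downarrow\{b',c'\}$. Labeled switchboards are structures in the language with a 4-ary relation for $<$ and 3-ary relations for $\uparrow,\downarrow$; "extends" means substructure in this language. Free amalgamation: let $M$ be a labeled switchboard, $S\subseteq M$, and $a_1,a_2$ distinct elements of $M\setminus S$. Then $a_1,a_2$ are freely amalgamated over $S$ if: (i) for $x,y\in S$, $\{a_1,x\}<\{a_2,y\}$ iff there is $\{p,q\}\in[S]^2$ with $\{a_1,x\}<\{p,q\}<\{a_2,y\}$;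 (ii) for $x,y\in S$, $\{a_2,y\}<\{a_1,x\}$ iff there is $\{p,q\}\in[S]^2$ with $\{a_2,y\}<\{p,q\}<\{a_1,x\}$; (iii) $\{a_1,a_2\}$ is incomparable to every other element of $[S\cup\{a_1,a_2\}]^2$; (iv) $x\downarrow\{a_1,a_2\}$ for every $x\in S$; (v) for $x\in S$, $a_1\uparrow\{a_2,x\}$ iff there is $\{p,q\}\in[S]^2$ with $a_1\uparrow\{p,q\}$ and $\{p,q\}<\{a_2,x\}$; (vi) for $x\in S$, $a_2\uparrow\{a_1,x\}$ iff there is $\{p,q\}\in[S]^2$ with $a_2\uparrow\{p,q\}$ and $\{p,q\}<\{a_1,x\}$. -}

module Defs where

open import Level using (0ℓ)
open import Data.Product using (Σ; _×_; ∃-syntax)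
open import Data.Sum using (_⊎_)
open import Data.Maybe using (Maybe; just; nothing)
open import Relation.Nullary using (¬_)
open import Relation.Binary.PropositionalEquality using (_≡_; _≢_)
open import Function.Bundles using (_⇔_)

-- A 2-element subset {a,b} of M is represented by an ordered pair (a,b) with
-- a ≢ b; all relations are required to be invariant under swapping and to
-- hold only on genuine 2-element subsets.
--   Lt a b c d   means  {a,b} < {c,d}
--   Up a b c     means  a ↑ {b,c}
--   Down a b c   means  a ↓ {b,c}
record LabeledSwitchboard (M : Set) : Set₁ where
  field
    Lt   : M → M → M → M → Set
    Up   : M → M → M → Set
    Down : M → M → M → Set
    Lt-wf₁ : ∀ {a b c d} → Lt a b c d → a ≢ b
    Lt-wf₂ : ∀ {a b c d} → Lt a b c d → c ≢ d
    Up-wf   : ∀ {a b c} → Up a b c → b ≢ c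
    Down-wf : ∀ {a b c} → Down a b c → b ≢ c
    Lt-swap₁ : ∀ {a b c d} → Lt a b c d → Lt b a c d
    Lt-swap₂ : ∀ {a b c d} → Lt a b c d → Lt a b d c
    Up-swap   : ∀ {a b c} → Up a b c → Up a c b
    Down-swap : ∀ {a b c} → Down a b c → Down a c b
    Lt-irrefl : ∀ {a b} → ¬ Lt a b a b
    Lt-trans  : ∀ {a b c d e f} → Lt a b c d → Lt c d e f → Lt a b e f
    switchboard : ∀ {x y z} → x ≢ y → x ≢ z → y ≢ z → ¬ Lt x y x z
    tri       : ∀ {a b c} → b ≢ c → Up a b c ⊎ (a ≡ b ⊎ a ≡ c) ⊎ Down a b c
    up-notin  : ∀ {a b c} → Up a b c → ¬ (a ≡ b ⊎ a ≡ c)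
    down-notin : ∀ {a b c} → Down a b c → ¬ (a ≡ b ⊎ a ≡ c)
    up-down   : ∀ {a b c} → Up a b c → ¬ Down a b c
    upward   : ∀ {a b c b' c'} → Up a b c → Lt b c b' c' → Up a b' c'
    downward : ∀ {a b c b' c'} → Down a b c → Lt b' c' b c → Down a b' c'

record IsEmbedding {A B : Set} (𝒜 : LabeledSwitchboard A) (ℬ : LabeledSwitchboard B)
                   (f : A → B) : Set where
  private
    module 𝒜 = LabeledSwitchboard 𝒜
    module ℬ = LabeledSwitchboard ℬ
  field
    injective : ∀ {x y} → f x ≡ f y → x ≡ y
    Lt-iff   : ∀ a b c d → 𝒜.Lt a b c d ⇔ ℬ.Lt (f a) (f b) (f c) (f d)
    Up-iff   : ∀ a b c → 𝒜.Up a b c ⇔ ℬ.Up (f a) (f b) (f c)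
    Down-iff : ∀ a b c → 𝒜.Down a b c ⇔ ℬ.Down (f a) (f b) (f c)

data Amalg (S : Set) : Set where
  old  : S → Amalg S
  new₁ : Amalg S
  new₂ : Amalg S

-- A_i = S ∪ {a_i} is modelled as Maybe S (nothing = a_i, just = inclusion of S)
ι₁ : {S : Set} → Maybe S → Amalg S
ι₁ (just s) = old s
ι₁ nothing  = new₁

ι₂ : {S : Set} → Maybe S → Amalg S
ι₂ (just s) = old s
ι₂ nothing  = new₂

record FreelyAmalgamated {S : Set} (ℳ : LabeledSwitchboard (Amalg S)) : Set where
  open LabeledSwitchboard ℳ
  field
    free-i   : ∀ x y → Lt new₁ (old x) new₂ (old y)
                 ⇔ (∃[ p ] ∃[ q ] (p ≢ q × Lt new₁ (old x) (old p) (old q)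
                                          × Lt (old p) (old q) new₂ (old y)))
    free-ii  : ∀ x y → Lt new₂ (old y) new₁ (old x)
                 ⇔ (∃[ p ] ∃[ q ] (p ≢ q × Lt new₂ (old y) (old p) (old q)
                                          × Lt (old p) (old q) new₁ (old x)))
    free-iii : ∀ c d → (¬ Lt new₁ new₂ c d) × (¬ Lt c d new₁ new₂)
    free-iv  : ∀ x → Down (old x) new₁ new₂
    free-v   : ∀ x → Up new₁ new₂ (old x)
                 ⇔ (∃[ p ] ∃[ q ] (p ≢ q × Up new₁ (old p) (old q)
                                          × Lt (old p) (old q) new₂ (old x)))
    free-vi  : ∀ x → Up new₂ new₁ (old x)
                 ⇔ (∃[ p ] ∃[ q ] (p ≢ q × Up new₂ (old p) (old q)
                                          × Lt (old p) (old q) new₁ (old x)))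

{-# OPTIONS --safe #-}
-- On the pairs of A₁ and of A₂ the amalgam M carries the structure of A₁ and A₂,
-- which agree on their common substructure S. On the remaining data the free
-- amalgam is forced: {a₁, a₂} is incomparable to every pair and every point of S
-- is ↓ of it; a pair through a₁ lies below a pair through a₂ iff a pair of S lies
-- between them; a₁ is ↑ of a pair of A₂ iff it is ↑ of a pair of S below that
-- pair, and ↓ of it otherwise (a dichotomy that needs excluded middle). Any chain
-- passing between A₁ and A₂ passes through a pair of S, where both agree with S,
-- so every axiom of M reduces to the axioms of A₁, A₂ and S.
module Submission where

open import Defs
open import Level using (0ℓ)
open import Axiom.ExcludedMiddle using (ExcludedMiddle)
open import Data.Empty using (⊥; ⊥-elim)
open import Data.Unit using (⊤; tt)
open import Data.Maybe using (Maybe; just; nothing)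
open import Data.Maybe.Properties using (just-injective)
open import Data.Product using (Σ; _×_; _,_; proj₁; proj₂; ∃-syntax)
open import Data.Sum as Sum using (_⊎_; inj₁; inj₂)
open import Function using (_∘_)
open import Function.Bundles using (_⇔_; mk⇔; Equivalence)
import Function.Properties.Equivalence as ⇔
open import Relation.Nullary using (¬_; yes; no)
open import Relation.Binary.PropositionalEquality using (_≡_; _≢_; refl; sym; cong; subst)

module Extension {S : Set} {𝒮 : LabeledSwitchboard S} {𝒜 : LabeledSwitchboard (Maybe S)}
                 (𝒮⊆𝒜 : IsEmbedding 𝒮 𝒜 just) where

  private
    module 𝒮 = LabeledSwitchboard 𝒮
    module 𝒜 = LabeledSwitchboard 𝒜
  open IsEmbedding 𝒮⊆𝒜
  open Equivalence

  Lt-lift : ∀ {s t u v} → 𝒮.Lt s t u v → 𝒜.Lt (just s) (just t) (just u) (just v)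
  Lt-lift = to (Lt-iff _ _ _ _)

  Lt-restrict : ∀ {s t u v} → 𝒜.Lt (just s) (just t) (just u) (just v) → 𝒮.Lt s t u v
  Lt-restrict = from (Lt-iff _ _ _ _)

  Up-lift : ∀ {s t u} → 𝒮.Up s t u → 𝒜.Up (just s) (just t) (just u)
  Up-lift = to (Up-iff _ _ _)

  Up-restrict : ∀ {s t u} → 𝒜.Up (just s) (just t) (just u) → 𝒮.Up s t u
  Up-restrict = from (Up-iff _ _ _)

  Down-lift : ∀ {s t u} → 𝒮.Down s t u → 𝒜.Down (just s) (just t) (just u)
  Down-lift = to (Down-iff _ _ _)

  Down-restrict : ∀ {s t u} → 𝒜.Down (just s) (just t) (just u) → 𝒮.Down s t u
  Down-restrict = from (Down-iff _ _ _)

-- LtVia and UpVia are the cross relations prescribed by conditions (i)/(ii) and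
-- (v)/(vi) of free amalgamation, with 𝒫, 𝒬 in the roles of A₁, A₂ or of A₂, A₁.
module Via {S : Set} {𝒮 : LabeledSwitchboard S} {𝒫 𝒬 : LabeledSwitchboard (Maybe S)}
           (𝒮⊆𝒫 : IsEmbedding 𝒮 𝒫 just) (𝒮⊆𝒬 : IsEmbedding 𝒮 𝒬 just) where

  private
    module 𝒫 = LabeledSwitchboard 𝒫
    module 𝒬 = LabeledSwitchboard 𝒬
    module P = Extension 𝒮⊆𝒫
    module Q = Extension 𝒮⊆𝒬

  LtVia : Maybe S → Maybe S → Maybe S → Maybe S → Set
  LtVia a b c d = ∃[ p ] ∃[ q ] (p ≢ q × 𝒫.Lt a b (just p) (just q) × 𝒬.Lt (just p) (just q) c d)

  UpVia : Maybe S → Maybe S → Set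
  UpVia c d = ∃[ p ] ∃[ q ] (p ≢ q × 𝒫.Up nothing (just p) (just q) × 𝒬.Lt (just p) (just q) c d)

  DownVia : Maybe S → Maybe S → Set
  DownVia c d = c ≢ d × ¬ UpVia c d

  LtVia-intro : ∀ {a b p q c d} → 𝒫.Lt a b (just p) (just q) → 𝒬.Lt (just p) (just q) c d → LtVia a b c d
  LtVia-intro l m = _ , _ , 𝒫.Lt-wf₂ l ∘ cong just , l , m

  LtVia-transˡ : ∀ {a b c d e f} → 𝒫.Lt a b c d → LtVia c d e f → LtVia a b e f
  LtVia-transˡ l (p , q , p≢q , m , n) = p , q , p≢q , 𝒫.Lt-trans l m , n

  LtVia-transʳ : ∀ {a b c d e f} → LtVia a b c d → 𝒬.Lt c d e f → LtVia a b e f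
  LtVia-transʳ (p , q , p≢q , l , m) n = p , q , p≢q , l , 𝒬.Lt-trans m n

  LtVia-fromS : ∀ {s t a b c d} → 𝒫.Lt (just s) (just t) a b → LtVia a b c d → 𝒬.Lt (just s) (just t) c d
  LtVia-fromS l (_ , _ , _ , m , n) = 𝒬.Lt-trans (Q.Lt-lift (P.Lt-restrict (𝒫.Lt-trans l m))) n

  LtVia-toS : ∀ {a b c d s t} → LtVia a b c d → 𝒬.Lt c d (just s) (just t) → 𝒫.Lt a b (just s) (just t)
  LtVia-toS (_ , _ , _ , l , m) n = 𝒫.Lt-trans l (P.Lt-lift (Q.Lt-restrict (𝒬.Lt-trans m n)))

  LtVia-swapˡ : ∀ {a b c d} → LtVia a b c d → LtVia b a c d
  LtVia-swapˡ (p , q , p≢q , l , m) = p , q , p≢q , 𝒫.Lt-swap₁ l , m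

  LtVia-swapʳ : ∀ {a b c d} → LtVia a b c d → LtVia a b d c
  LtVia-swapʳ (p , q , p≢q , l , m) = p , q , p≢q , l , 𝒬.Lt-swap₂ m

  LtVia-distinctˡ : ∀ {a b c d} → LtVia a b c d → a ≢ b
  LtVia-distinctˡ (_ , _ , _ , l , _) = 𝒫.Lt-wf₁ l

  LtVia-distinctʳ : ∀ {a b c d} → LtVia a b c d → c ≢ d
  LtVia-distinctʳ (_ , _ , _ , _ , m) = 𝒬.Lt-wf₂ m

  Up-transport : ∀ {s a b c d} → 𝒫.Up (just s) a b → LtVia a b c d → 𝒬.Up (just s) c d
  Up-transport u (_ , _ , _ , l , m) = 𝒬.upward (Q.Up-lift (P.Up-restrict (𝒫.upward u l))) m

  Down-transport : ∀ {s a b c d} → 𝒬.Down (just s) c d → LtVia a b c d → 𝒫.Down (just s) a b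
  Down-transport d (_ , _ , _ , l , m) = 𝒫.downward (P.Down-lift (Q.Down-restrict (𝒬.downward d m))) l

  -- s ↑ {p, q} would give s ↑ {s, b}, s ↓ {p, q} would give s ↓ {s, a}, and
  -- s ∈ {p, q} contradicts the switchboard axiom of 𝒫 (a, b the new points).
  switchboard-via : ∀ {s} → ¬ LtVia (just s) nothing (just s) nothing
  switchboard-via {s} (p , q , _ , l , m) with 𝒫.tri {just s} (𝒫.Lt-wf₂ l)
  ... | inj₁ up                 = 𝒬.up-notin (𝒬.upward (Q.Up-lift (P.Up-restrict up)) m) (inj₁ refl)
  ... | inj₂ (inj₂ down)        = 𝒫.down-notin (𝒫.downward down l) (inj₁ refl)
  ... | inj₂ (inj₁ (inj₁ refl)) = 𝒫.switchboard (λ ()) (𝒫.Lt-wf₂ l) (λ ()) l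
  ... | inj₂ (inj₁ (inj₂ refl)) = 𝒫.switchboard (λ ()) (𝒫.Lt-wf₂ l ∘ sym) (λ ()) (𝒫.Lt-swap₂ l)

  UpVia-fromS : ∀ {s t c d} → 𝒫.Up nothing (just s) (just t) → 𝒬.Lt (just s) (just t) c d → UpVia c d
  UpVia-fromS u l = _ , _ , 𝒫.Up-wf u ∘ cong just , u , l

  UpVia-toS : ∀ {a b s t} → UpVia a b → 𝒬.Lt a b (just s) (just t) → 𝒫.Up nothing (just s) (just t)
  UpVia-toS (_ , _ , _ , u , m) l = 𝒫.upward u (P.Lt-lift (Q.Lt-restrict (𝒬.Lt-trans m l)))

  Up-UpVia : ∀ {a b c d} → 𝒫.Up nothing a b → LtVia a b c d → UpVia c d
  Up-UpVia u (p , q , p≢q , l , m) = p , q , p≢q , 𝒫.upward u l , m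

  UpVia-upward : ∀ {a b c d} → UpVia a b → 𝒬.Lt a b c d → UpVia c d
  UpVia-upward (p , q , p≢q , u , m) l = p , q , p≢q , u , 𝒬.Lt-trans m l

  UpVia-swap : ∀ {c d} → UpVia c d → UpVia d c
  UpVia-swap (p , q , p≢q , u , m) = p , q , p≢q , u , 𝒬.Lt-swap₂ m

  UpVia-distinct : ∀ {c d} → UpVia c d → c ≢ d
  UpVia-distinct (_ , _ , _ , _ , m) = 𝒬.Lt-wf₂ m

  UpVia-dichotomy : ExcludedMiddle 0ℓ → ∀ {c d} → c ≢ d → UpVia c d ⊎ DownVia c d
  UpVia-dichotomy em {c} {d} c≢d with em {UpVia c d}
  ... | yes up = inj₁ up
  ... | no ¬up = inj₂ (c≢d , ¬up)

  DownVia-fromS : ∀ {s t a b} → 𝒫.Down nothing (just s) (just t) → 𝒬.Lt a b (just s) (just t) → DownVia a b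
  DownVia-fromS d l = 𝒬.Lt-wf₁ l , λ up → 𝒫.up-down (UpVia-toS up l) d

  DownVia-toS : ∀ {s t c d} → DownVia c d → 𝒬.Lt (just s) (just t) c d → 𝒫.Down nothing (just s) (just t)
  DownVia-toS (_ , ¬up) l with 𝒫.tri {nothing} (𝒬.Lt-wf₁ l)
  ... | inj₁ up                 = ⊥-elim (¬up (UpVia-fromS up l))
  ... | inj₂ (inj₁ (inj₁ ()))
  ... | inj₂ (inj₁ (inj₂ ()))
  ... | inj₂ (inj₂ down)        = down

  DownVia-Down : ∀ {a b c d} → DownVia c d → LtVia a b c d → 𝒫.Down nothing a b
  DownVia-Down d (_ , _ , _ , l , m) = 𝒫.downward (DownVia-toS d m) l

  DownVia-downward : ∀ {a b c d} → DownVia c d → 𝒬.Lt a b c d → DownVia a b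
  DownVia-downward (_ , ¬up) l = 𝒬.Lt-wf₁ l , λ up → ¬up (UpVia-upward up l)

  DownVia-swap : ∀ {c d} → DownVia c d → DownVia d c
  DownVia-swap (c≢d , ¬up) = c≢d ∘ sym , ¬up ∘ UpVia-swap

module FreeAmalgam (em : ExcludedMiddle 0ℓ) {S : Set} {𝒮 : LabeledSwitchboard S}
                   {𝒜₁ 𝒜₂ : LabeledSwitchboard (Maybe S)}
                   (𝒮⊆𝒜₁ : IsEmbedding 𝒮 𝒜₁ just) (𝒮⊆𝒜₂ : IsEmbedding 𝒮 𝒜₂ just) where

  private
    module 𝒮 = LabeledSwitchboard 𝒮
    module 𝒜₁ = LabeledSwitchboard 𝒜₁
    module 𝒜₂ = LabeledSwitchboard 𝒜₂
    module E₁ = Extension 𝒮⊆𝒜₁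
    module E₂ = Extension 𝒮⊆𝒜₂
    module ₁₂ = Via 𝒮⊆𝒜₁ 𝒮⊆𝒜₂
    module ₂₁ = Via 𝒮⊆𝒜₂ 𝒮⊆𝒜₁

  old-injective : ∀ {s t} → old {S} s ≡ old t → s ≡ t
  old-injective refl = refl

  ι₁-injective : ∀ {x y : Maybe S} → ι₁ x ≡ ι₁ y → x ≡ y
  ι₁-injective {just _}  {just _}  refl = refl
  ι₁-injective {nothing} {nothing} refl = refl
  ι₁-injective {just _}  {nothing} ()
  ι₁-injective {nothing} {just _}  ()

  ι₂-injective : ∀ {x y : Maybe S} → ι₂ x ≡ ι₂ y → x ≡ y
  ι₂-injective {just _}  {just _}  refl = refl
  ι₂-injective {nothing} {nothing} refl = refl
  ι₂-injective {just _}  {nothing} ()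
  ι₂-injective {nothing} {just _}  ()

  new₁≢ι₂ : ∀ x → new₁ ≢ ι₂ {S} x
  new₁≢ι₂ (just _) ()
  new₁≢ι₂ nothing  ()

  new₂≢ι₁ : ∀ x → new₂ ≢ ι₁ {S} x
  new₂≢ι₁ (just _) ()
  new₂≢ι₁ nothing  ()

  -- A 2-subset of M = S ∪ {a₁, a₂} as a 2-subset of S, of A₁ = S ∪ {a₁},
  -- of A₂ = S ∪ {a₂}, or {a₁, a₂}.
  data Pair : Set where
    inS   : S → S → Pair
    in₁   : Maybe S → Maybe S → Pair
    in₂   : Maybe S → Maybe S → Pair
    fresh : Pair

  pair : Amalg S → Amalg S → Pair
  pair (old s) (old t) = inS s t
  pair (old s) new₁    = in₁ (just s) nothing
  pair (old s) new₂    = in₂ (just s) nothing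
  pair new₁    (old t) = in₁ nothing (just t)
  pair new₁    new₁    = in₁ nothing nothing
  pair new₁    new₂    = fresh
  pair new₂    (old t) = in₂ nothing (just t)
  pair new₂    new₁    = fresh
  pair new₂    new₂    = in₂ nothing nothing

  ends : Pair → Amalg S × Amalg S
  ends (inS s t) = old s , old t
  ends (in₁ u v) = ι₁ u , ι₁ v
  ends (in₂ u v) = ι₂ u , ι₂ v
  ends fresh     = new₁ , new₂

  _∈ₚ_ : Amalg S → Pair → Set
  a ∈ₚ K = a ≡ proj₁ (ends K) ⊎ a ≡ proj₂ (ends K)

  ∈ₚ-pair : ∀ {a} b c → a ∈ₚ pair b c ⇔ (a ≡ b ⊎ a ≡ c)
  ∈ₚ-pair (old _) (old _) = ⇔.refl
  ∈ₚ-pair (old _) new₁    = ⇔.refl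
  ∈ₚ-pair (old _) new₂    = ⇔.refl
  ∈ₚ-pair new₁    (old _) = ⇔.refl
  ∈ₚ-pair new₁    new₁    = ⇔.refl
  ∈ₚ-pair new₁    new₂    = ⇔.refl
  ∈ₚ-pair new₂    (old _) = ⇔.refl
  ∈ₚ-pair new₂    new₁    = mk⇔ Sum.swap Sum.swap
  ∈ₚ-pair new₂    new₂    = ⇔.refl

  Distinct : Pair → Set
  Distinct (inS s t) = s ≢ t
  Distinct (in₁ u v) = u ≢ v
  Distinct (in₂ u v) = u ≢ v
  Distinct fresh     = ⊤

  pair-distinct : ∀ a b → a ≢ b → Distinct (pair a b)
  pair-distinct (old _) (old _) a≢b = a≢b ∘ cong old
  pair-distinct (old _) new₁    a≢b = a≢b ∘ cong ι₁
  pair-distinct (old _) new₂    a≢b = a≢b ∘ cong ι₂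
  pair-distinct new₁    (old _) a≢b = a≢b ∘ cong ι₁
  pair-distinct new₁    new₁    a≢b = a≢b ∘ cong ι₁
  pair-distinct new₁    new₂    _   = tt
  pair-distinct new₂    (old _) a≢b = a≢b ∘ cong ι₂
  pair-distinct new₂    new₁    _   = tt
  pair-distinct new₂    new₂    a≢b = a≢b ∘ cong ι₂

  distinct-pair : ∀ a b → Distinct (pair a b) → a ≢ b
  distinct-pair (old _) _ d refl = d refl
  distinct-pair new₁    _ d refl = d refl
  distinct-pair new₂    _ d refl = d refl

  swapₚ : Pair → Pair
  swapₚ (inS s t) = inS t s
  swapₚ (in₁ u v) = in₁ v u
  swapₚ (in₂ u v) = in₂ v u
  swapₚ fresh     = fresh

  pair-swap : ∀ a b → pair b a ≡ swapₚ (pair a b)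
  pair-swap (old _) (old _) = refl
  pair-swap (old _) new₁    = refl
  pair-swap (old _) new₂    = refl
  pair-swap new₁    (old _) = refl
  pair-swap new₁    new₁    = refl
  pair-swap new₁    new₂    = refl
  pair-swap new₂    (old _) = refl
  pair-swap new₂    new₁    = refl
  pair-swap new₂    new₂    = refl

  infix 4 _≺_ _↑_ _↓_

  _≺_ : Pair → Pair → Set
  _         ≺ fresh     = ⊥
  fresh     ≺ _         = ⊥
  inS s t   ≺ inS u v   = 𝒮.Lt s t u v
  inS s t   ≺ in₁ u v   = 𝒜₁.Lt (just s) (just t) u v
  inS s t   ≺ in₂ u v   = 𝒜₂.Lt (just s) (just t) u v
  in₁ a b   ≺ inS u v   = 𝒜₁.Lt a b (just u) (just v)
  in₁ a b   ≺ in₁ u v   = 𝒜₁.Lt a b u v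
  in₁ a b   ≺ in₂ u v   = ₁₂.LtVia a b u v
  in₂ a b   ≺ inS u v   = 𝒜₂.Lt a b (just u) (just v)
  in₂ a b   ≺ in₁ u v   = ₂₁.LtVia a b u v
  in₂ a b   ≺ in₂ u v   = 𝒜₂.Lt a b u v

  _↑_ : Amalg S → Pair → Set
  _     ↑ fresh   = ⊥
  old s ↑ inS t u = 𝒮.Up s t u
  old s ↑ in₁ u v = 𝒜₁.Up (just s) u v
  old s ↑ in₂ u v = 𝒜₂.Up (just s) u v
  new₁  ↑ inS t u = 𝒜₁.Up nothing (just t) (just u)
  new₁  ↑ in₁ u v = 𝒜₁.Up nothing u v
  new₁  ↑ in₂ u v = ₁₂.UpVia u v
  new₂  ↑ inS t u = 𝒜₂.Up nothing (just t) (just u)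
  new₂  ↑ in₁ u v = ₂₁.UpVia u v
  new₂  ↑ in₂ u v = 𝒜₂.Up nothing u v

  _↓_ : Amalg S → Pair → Set
  old _ ↓ fresh   = ⊤
  new₁  ↓ fresh   = ⊥
  new₂  ↓ fresh   = ⊥
  old s ↓ inS t u = 𝒮.Down s t u
  old s ↓ in₁ u v = 𝒜₁.Down (just s) u v
  old s ↓ in₂ u v = 𝒜₂.Down (just s) u v
  new₁  ↓ inS t u = 𝒜₁.Down nothing (just t) (just u)
  new₁  ↓ in₁ u v = 𝒜₁.Down nothing u v
  new₁  ↓ in₂ u v = ₁₂.DownVia u v
  new₂  ↓ inS t u = 𝒜₂.Down nothing (just t) (just u)
  new₂  ↓ in₁ u v = ₂₁.DownVia u v
  new₂  ↓ in₂ u v = 𝒜₂.Down nothing u v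

  fresh-⊀ : ∀ K → ¬ fresh ≺ K
  fresh-⊀ (inS _ _) ()
  fresh-⊀ (in₁ _ _) ()
  fresh-⊀ (in₂ _ _) ()
  fresh-⊀ fresh     ()

  ≺-irrefl : ∀ K → ¬ K ≺ K
  ≺-irrefl (inS _ _) = 𝒮.Lt-irrefl
  ≺-irrefl (in₁ _ _) = 𝒜₁.Lt-irrefl
  ≺-irrefl (in₂ _ _) = 𝒜₂.Lt-irrefl
  ≺-irrefl fresh     = λ ()

  ≺-trans : ∀ K L N → K ≺ L → L ≺ N → K ≺ N
  ≺-trans _         _         fresh     _ ()
  ≺-trans _         fresh     _         ()
  ≺-trans fresh     L         _         l _ = ⊥-elim (fresh-⊀ L l)
  ≺-trans (inS _ _) (inS _ _) (inS _ _) l m = 𝒮.Lt-trans l m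
  ≺-trans (inS _ _) (inS _ _) (in₁ _ _) l m = 𝒜₁.Lt-trans (E₁.Lt-lift l) m
  ≺-trans (inS _ _) (inS _ _) (in₂ _ _) l m = 𝒜₂.Lt-trans (E₂.Lt-lift l) m
  ≺-trans (inS _ _) (in₁ _ _) (inS _ _) l m = E₁.Lt-restrict (𝒜₁.Lt-trans l m)
  ≺-trans (inS _ _) (in₁ _ _) (in₁ _ _) l m = 𝒜₁.Lt-trans l m
  ≺-trans (inS _ _) (in₁ _ _) (in₂ _ _) l m = ₁₂.LtVia-fromS l m
  ≺-trans (inS _ _) (in₂ _ _) (inS _ _) l m = E₂.Lt-restrict (𝒜₂.Lt-trans l m)
  ≺-trans (inS _ _) (in₂ _ _) (in₁ _ _) l m = ₂₁.LtVia-fromS l m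
  ≺-trans (inS _ _) (in₂ _ _) (in₂ _ _) l m = 𝒜₂.Lt-trans l m
  ≺-trans (in₁ _ _) (inS _ _) (inS _ _) l m = 𝒜₁.Lt-trans l (E₁.Lt-lift m)
  ≺-trans (in₁ _ _) (inS _ _) (in₁ _ _) l m = 𝒜₁.Lt-trans l m
  ≺-trans (in₁ _ _) (inS _ _) (in₂ _ _) l m = ₁₂.LtVia-intro l m
  ≺-trans (in₁ _ _) (in₁ _ _) (inS _ _) l m = 𝒜₁.Lt-trans l m
  ≺-trans (in₁ _ _) (in₁ _ _) (in₁ _ _) l m = 𝒜₁.Lt-trans l m
  ≺-trans (in₁ _ _) (in₁ _ _) (in₂ _ _) l m = ₁₂.LtVia-transˡ l m
  ≺-trans (in₁ _ _) (in₂ _ _) (inS _ _) l m = ₁₂.LtVia-toS l m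
  ≺-trans (in₁ _ _) (in₂ _ _) (in₁ _ _) (_ , _ , _ , l , l′) m = 𝒜₁.Lt-trans l (₂₁.LtVia-fromS l′ m)
  ≺-trans (in₁ _ _) (in₂ _ _) (in₂ _ _) l m = ₁₂.LtVia-transʳ l m
  ≺-trans (in₂ _ _) (inS _ _) (inS _ _) l m = 𝒜₂.Lt-trans l (E₂.Lt-lift m)
  ≺-trans (in₂ _ _) (inS _ _) (in₁ _ _) l m = ₂₁.LtVia-intro l m
  ≺-trans (in₂ _ _) (inS _ _) (in₂ _ _) l m = 𝒜₂.Lt-trans l m
  ≺-trans (in₂ _ _) (in₁ _ _) (inS _ _) l m = ₂₁.LtVia-toS l m
  ≺-trans (in₂ _ _) (in₁ _ _) (in₁ _ _) l m = ₂₁.LtVia-transʳ l m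
  ≺-trans (in₂ _ _) (in₁ _ _) (in₂ _ _) (_ , _ , _ , l , l′) m = 𝒜₂.Lt-trans l (₁₂.LtVia-fromS l′ m)
  ≺-trans (in₂ _ _) (in₂ _ _) (inS _ _) l m = 𝒜₂.Lt-trans l m
  ≺-trans (in₂ _ _) (in₂ _ _) (in₁ _ _) l m = ₂₁.LtVia-transˡ l m
  ≺-trans (in₂ _ _) (in₂ _ _) (in₂ _ _) l m = 𝒜₂.Lt-trans l m

  ≺-distinctˡ : ∀ K L → K ≺ L → Distinct K
  ≺-distinctˡ _         fresh     ()
  ≺-distinctˡ fresh     _         _ = tt
  ≺-distinctˡ (inS _ _) (inS _ _) l = 𝒮.Lt-wf₁ l
  ≺-distinctˡ (inS _ _) (in₁ _ _) l = 𝒜₁.Lt-wf₁ l ∘ cong just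
  ≺-distinctˡ (inS _ _) (in₂ _ _) l = 𝒜₂.Lt-wf₁ l ∘ cong just
  ≺-distinctˡ (in₁ _ _) (inS _ _) l = 𝒜₁.Lt-wf₁ l
  ≺-distinctˡ (in₁ _ _) (in₁ _ _) l = 𝒜₁.Lt-wf₁ l
  ≺-distinctˡ (in₁ _ _) (in₂ _ _) l = ₁₂.LtVia-distinctˡ l
  ≺-distinctˡ (in₂ _ _) (inS _ _) l = 𝒜₂.Lt-wf₁ l
  ≺-distinctˡ (in₂ _ _) (in₁ _ _) l = ₂₁.LtVia-distinctˡ l
  ≺-distinctˡ (in₂ _ _) (in₂ _ _) l = 𝒜₂.Lt-wf₁ l

  ≺-distinctʳ : ∀ K L → K ≺ L → Distinct L
  ≺-distinctʳ _         fresh     ()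
  ≺-distinctʳ fresh     L         l = ⊥-elim (fresh-⊀ L l)
  ≺-distinctʳ (inS _ _) (inS _ _) l = 𝒮.Lt-wf₂ l
  ≺-distinctʳ (inS _ _) (in₁ _ _) l = 𝒜₁.Lt-wf₂ l
  ≺-distinctʳ (inS _ _) (in₂ _ _) l = 𝒜₂.Lt-wf₂ l
  ≺-distinctʳ (in₁ _ _) (inS _ _) l = 𝒜₁.Lt-wf₂ l ∘ cong just
  ≺-distinctʳ (in₁ _ _) (in₁ _ _) l = 𝒜₁.Lt-wf₂ l
  ≺-distinctʳ (in₁ _ _) (in₂ _ _) l = ₁₂.LtVia-distinctʳ l
  ≺-distinctʳ (in₂ _ _) (inS _ _) l = 𝒜₂.Lt-wf₂ l ∘ cong just
  ≺-distinctʳ (in₂ _ _) (in₁ _ _) l = ₂₁.LtVia-distinctʳ l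
  ≺-distinctʳ (in₂ _ _) (in₂ _ _) l = 𝒜₂.Lt-wf₂ l

  ↑-distinct : ∀ a K → a ↑ K → Distinct K
  ↑-distinct _       fresh     ()
  ↑-distinct (old _) (inS _ _) u = 𝒮.Up-wf u
  ↑-distinct (old _) (in₁ _ _) u = 𝒜₁.Up-wf u
  ↑-distinct (old _) (in₂ _ _) u = 𝒜₂.Up-wf u
  ↑-distinct new₁    (inS _ _) u = 𝒜₁.Up-wf u ∘ cong just
  ↑-distinct new₁    (in₁ _ _) u = 𝒜₁.Up-wf u
  ↑-distinct new₁    (in₂ _ _) u = ₁₂.UpVia-distinct u
  ↑-distinct new₂    (inS _ _) u = 𝒜₂.Up-wf u ∘ cong just
  ↑-distinct new₂    (in₁ _ _) u = ₂₁.UpVia-distinct u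
  ↑-distinct new₂    (in₂ _ _) u = 𝒜₂.Up-wf u

  ↓-distinct : ∀ a K → a ↓ K → Distinct K
  ↓-distinct _       fresh     _ = tt
  ↓-distinct (old _) (inS _ _) d = 𝒮.Down-wf d
  ↓-distinct (old _) (in₁ _ _) d = 𝒜₁.Down-wf d
  ↓-distinct (old _) (in₂ _ _) d = 𝒜₂.Down-wf d
  ↓-distinct new₁    (inS _ _) d = 𝒜₁.Down-wf d ∘ cong just
  ↓-distinct new₁    (in₁ _ _) d = 𝒜₁.Down-wf d
  ↓-distinct new₁    (in₂ _ _) d = proj₁ d
  ↓-distinct new₂    (inS _ _) d = 𝒜₂.Down-wf d ∘ cong just
  ↓-distinct new₂    (in₁ _ _) d = proj₁ d
  ↓-distinct new₂    (in₂ _ _) d = 𝒜₂.Down-wf d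

  ≺-swapˡ : ∀ K L → K ≺ L → swapₚ K ≺ L
  ≺-swapˡ _         fresh     ()
  ≺-swapˡ fresh     L         l = ⊥-elim (fresh-⊀ L l)
  ≺-swapˡ (inS _ _) (inS _ _) l = 𝒮.Lt-swap₁ l
  ≺-swapˡ (inS _ _) (in₁ _ _) l = 𝒜₁.Lt-swap₁ l
  ≺-swapˡ (inS _ _) (in₂ _ _) l = 𝒜₂.Lt-swap₁ l
  ≺-swapˡ (in₁ _ _) (inS _ _) l = 𝒜₁.Lt-swap₁ l
  ≺-swapˡ (in₁ _ _) (in₁ _ _) l = 𝒜₁.Lt-swap₁ l
  ≺-swapˡ (in₁ _ _) (in₂ _ _) l = ₁₂.LtVia-swapˡ l
  ≺-swapˡ (in₂ _ _) (inS _ _) l = 𝒜₂.Lt-swap₁ l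
  ≺-swapˡ (in₂ _ _) (in₁ _ _) l = ₂₁.LtVia-swapˡ l
  ≺-swapˡ (in₂ _ _) (in₂ _ _) l = 𝒜₂.Lt-swap₁ l

  ≺-swapʳ : ∀ K L → K ≺ L → K ≺ swapₚ L
  ≺-swapʳ _         fresh     ()
  ≺-swapʳ fresh     L         l = ⊥-elim (fresh-⊀ L l)
  ≺-swapʳ (inS _ _) (inS _ _) l = 𝒮.Lt-swap₂ l
  ≺-swapʳ (inS _ _) (in₁ _ _) l = 𝒜₁.Lt-swap₂ l
  ≺-swapʳ (inS _ _) (in₂ _ _) l = 𝒜₂.Lt-swap₂ l
  ≺-swapʳ (in₁ _ _) (inS _ _) l = 𝒜₁.Lt-swap₂ l
  ≺-swapʳ (in₁ _ _) (in₁ _ _) l = 𝒜₁.Lt-swap₂ l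
  ≺-swapʳ (in₁ _ _) (in₂ _ _) l = ₁₂.LtVia-swapʳ l
  ≺-swapʳ (in₂ _ _) (inS _ _) l = 𝒜₂.Lt-swap₂ l
  ≺-swapʳ (in₂ _ _) (in₁ _ _) l = ₂₁.LtVia-swapʳ l
  ≺-swapʳ (in₂ _ _) (in₂ _ _) l = 𝒜₂.Lt-swap₂ l

  ↑-swap : ∀ a K → a ↑ K → a ↑ swapₚ K
  ↑-swap _       fresh     ()
  ↑-swap (old _) (inS _ _) u = 𝒮.Up-swap u
  ↑-swap (old _) (in₁ _ _) u = 𝒜₁.Up-swap u
  ↑-swap (old _) (in₂ _ _) u = 𝒜₂.Up-swap u
  ↑-swap new₁    (inS _ _) u = 𝒜₁.Up-swap u
  ↑-swap new₁    (in₁ _ _) u = 𝒜₁.Up-swap u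
  ↑-swap new₁    (in₂ _ _) u = ₁₂.UpVia-swap u
  ↑-swap new₂    (inS _ _) u = 𝒜₂.Up-swap u
  ↑-swap new₂    (in₁ _ _) u = ₂₁.UpVia-swap u
  ↑-swap new₂    (in₂ _ _) u = 𝒜₂.Up-swap u

  ↓-swap : ∀ a K → a ↓ K → a ↓ swapₚ K
  ↓-swap (old _) fresh     d = d
  ↓-swap (old _) (inS _ _) d = 𝒮.Down-swap d
  ↓-swap (old _) (in₁ _ _) d = 𝒜₁.Down-swap d
  ↓-swap (old _) (in₂ _ _) d = 𝒜₂.Down-swap d
  ↓-swap new₁    (inS _ _) d = 𝒜₁.Down-swap d
  ↓-swap new₁    (in₁ _ _) d = 𝒜₁.Down-swap d
  ↓-swap new₁    (in₂ _ _) d = ₁₂.DownVia-swap d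
  ↓-swap new₂    (inS _ _) d = 𝒜₂.Down-swap d
  ↓-swap new₂    (in₁ _ _) d = ₂₁.DownVia-swap d
  ↓-swap new₂    (in₂ _ _) d = 𝒜₂.Down-swap d

  switchboard₁ : ∀ {x y z} → ι₁ x ≢ ι₁ y → ι₁ x ≢ ι₁ z → ι₁ y ≢ ι₁ z → ¬ 𝒜₁.Lt x y x z
  switchboard₁ x≢y x≢z y≢z = 𝒜₁.switchboard (x≢y ∘ cong ι₁) (x≢z ∘ cong ι₁) (y≢z ∘ cong ι₁)

  switchboard₂ : ∀ {x y z} → ι₂ x ≢ ι₂ y → ι₂ x ≢ ι₂ z → ι₂ y ≢ ι₂ z → ¬ 𝒜₂.Lt x y x z
  switchboard₂ x≢y x≢z y≢z = 𝒜₂.switchboard (x≢y ∘ cong ι₂) (x≢z ∘ cong ι₂) (y≢z ∘ cong ι₂)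

  ≺-switchboard : ∀ x y z → x ≢ y → x ≢ z → y ≢ z → ¬ pair x y ≺ pair x z
  ≺-switchboard (old _) (old _) (old _) x≢y x≢z y≢z =
    𝒮.switchboard (x≢y ∘ cong old) (x≢z ∘ cong old) (y≢z ∘ cong old)
  ≺-switchboard (old _) (old _) new₁    = switchboard₁
  ≺-switchboard (old _) new₁    (old _) = switchboard₁
  ≺-switchboard (old _) new₁    new₁    = switchboard₁
  ≺-switchboard new₁    (old _) (old _) = switchboard₁
  ≺-switchboard new₁    (old _) new₁    = switchboard₁
  ≺-switchboard new₁    new₁    (old _) = switchboard₁
  ≺-switchboard new₁    new₁    new₁    = switchboard₁
  ≺-switchboard (old _) (old _) new₂    = switchboard₂
  ≺-switchboard (old _) new₂    (old _) = switchboard₂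
  ≺-switchboard (old _) new₂    new₂    = switchboard₂
  ≺-switchboard new₂    (old _) (old _) = switchboard₂
  ≺-switchboard new₂    (old _) new₂    = switchboard₂
  ≺-switchboard new₂    new₂    (old _) = switchboard₂
  ≺-switchboard new₂    new₂    new₂    = switchboard₂
  ≺-switchboard (old _) new₁    new₂    _ _ _ = ₁₂.switchboard-via
  ≺-switchboard (old _) new₂    new₁    _ _ _ = ₂₁.switchboard-via
  ≺-switchboard new₁    new₂    z       _ _ _ = fresh-⊀ (pair new₁ z)
  ≺-switchboard new₂    new₁    z       _ _ _ = fresh-⊀ (pair new₂ z)
  ≺-switchboard new₁    (old _) new₂    _ _ _ = λ ()
  ≺-switchboard new₂    (old _) new₁    _ _ _ = λ ()
  ≺-switchboard new₁    new₁    new₂    _ _ _ = λ ()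
  ≺-switchboard new₂    new₂    new₁    _ _ _ = λ ()

  map-∈ : ∀ {X U D : Set} (f : X → Amalg S) {x y z} →
          U ⊎ (x ≡ y ⊎ x ≡ z) ⊎ D → U ⊎ (f x ≡ f y ⊎ f x ≡ f z) ⊎ D
  map-∈ f = Sum.map₂ (Sum.map₁ (Sum.map (cong f) (cong f)))

  trichotomy : ∀ a K → Distinct K → a ↑ K ⊎ a ∈ₚ K ⊎ a ↓ K
  trichotomy (old _) (inS _ _) d = map-∈ old (𝒮.tri d)
  trichotomy (old _) (in₁ _ _) d = map-∈ ι₁ (𝒜₁.tri d)
  trichotomy (old _) (in₂ _ _) d = map-∈ ι₂ (𝒜₂.tri d)
  trichotomy (old _) fresh     _ = inj₂ (inj₂ tt)
  trichotomy new₁    (inS _ _) d = map-∈ ι₁ (𝒜₁.tri (d ∘ just-injective))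
  trichotomy new₁    (in₁ _ _) d = map-∈ ι₁ (𝒜₁.tri d)
  trichotomy new₁    (in₂ _ _) d = Sum.map₂ inj₂ (₁₂.UpVia-dichotomy em d)
  trichotomy new₁    fresh     _ = inj₂ (inj₁ (inj₁ refl))
  trichotomy new₂    (inS _ _) d = map-∈ ι₂ (𝒜₂.tri (d ∘ just-injective))
  trichotomy new₂    (in₁ _ _) d = Sum.map₂ inj₂ (₂₁.UpVia-dichotomy em d)
  trichotomy new₂    (in₂ _ _) d = map-∈ ι₂ (𝒜₂.tri d)
  trichotomy new₂    fresh     _ = inj₂ (inj₁ (inj₂ refl))

  ↑-∉ : ∀ a K → a ↑ K → ¬ a ∈ₚ K
  ↑-∉ _       fresh     ()
  ↑-∉ (old _) (inS _ _) u = 𝒮.up-notin u ∘ Sum.map old-injective old-injective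
  ↑-∉ (old _) (in₁ _ _) u = 𝒜₁.up-notin u ∘ Sum.map ι₁-injective ι₁-injective
  ↑-∉ (old _) (in₂ _ _) u = 𝒜₂.up-notin u ∘ Sum.map ι₂-injective ι₂-injective
  ↑-∉ new₁    (inS _ _) u = 𝒜₁.up-notin u ∘ Sum.map ι₁-injective ι₁-injective
  ↑-∉ new₁    (in₁ _ _) u = 𝒜₁.up-notin u ∘ Sum.map ι₁-injective ι₁-injective
  ↑-∉ new₁    (in₂ v w) _ = Sum.[ new₁≢ι₂ v , new₁≢ι₂ w ]
  ↑-∉ new₂    (inS _ _) u = 𝒜₂.up-notin u ∘ Sum.map ι₂-injective ι₂-injective
  ↑-∉ new₂    (in₁ v w) _ = Sum.[ new₂≢ι₁ v , new₂≢ι₁ w ]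
  ↑-∉ new₂    (in₂ _ _) u = 𝒜₂.up-notin u ∘ Sum.map ι₂-injective ι₂-injective

  ↓-∉ : ∀ a K → a ↓ K → ¬ a ∈ₚ K
  ↓-∉ (old _) fresh     _ = Sum.[ (λ ()) , (λ ()) ]
  ↓-∉ (old _) (inS _ _) d = 𝒮.down-notin d ∘ Sum.map old-injective old-injective
  ↓-∉ (old _) (in₁ _ _) d = 𝒜₁.down-notin d ∘ Sum.map ι₁-injective ι₁-injective
  ↓-∉ (old _) (in₂ _ _) d = 𝒜₂.down-notin d ∘ Sum.map ι₂-injective ι₂-injective
  ↓-∉ new₁    (inS _ _) d = 𝒜₁.down-notin d ∘ Sum.map ι₁-injective ι₁-injective
  ↓-∉ new₁    (in₁ _ _) d = 𝒜₁.down-notin d ∘ Sum.map ι₁-injective ι₁-injective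
  ↓-∉ new₁    (in₂ v w) _ = Sum.[ new₁≢ι₂ v , new₁≢ι₂ w ]
  ↓-∉ new₂    (inS _ _) d = 𝒜₂.down-notin d ∘ Sum.map ι₂-injective ι₂-injective
  ↓-∉ new₂    (in₁ v w) _ = Sum.[ new₂≢ι₁ v , new₂≢ι₁ w ]
  ↓-∉ new₂    (in₂ _ _) d = 𝒜₂.down-notin d ∘ Sum.map ι₂-injective ι₂-injective

  ↑⇒¬↓ : ∀ a K → a ↑ K → ¬ a ↓ K
  ↑⇒¬↓ _       fresh     ()
  ↑⇒¬↓ (old _) (inS _ _) = 𝒮.up-down
  ↑⇒¬↓ (old _) (in₁ _ _) = 𝒜₁.up-down
  ↑⇒¬↓ (old _) (in₂ _ _) = 𝒜₂.up-down
  ↑⇒¬↓ new₁    (inS _ _) = 𝒜₁.up-down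
  ↑⇒¬↓ new₁    (in₁ _ _) = 𝒜₁.up-down
  ↑⇒¬↓ new₁    (in₂ _ _) = λ up (_ , ¬up) → ¬up up
  ↑⇒¬↓ new₂    (inS _ _) = 𝒜₂.up-down
  ↑⇒¬↓ new₂    (in₁ _ _) = λ up (_ , ¬up) → ¬up up
  ↑⇒¬↓ new₂    (in₂ _ _) = 𝒜₂.up-down

  ↑-upward : ∀ a K L → a ↑ K → K ≺ L → a ↑ L
  ↑-upward _       _         fresh     _ ()
  ↑-upward _       fresh     _         ()
  ↑-upward (old _) (inS _ _) (inS _ _) u l = 𝒮.upward u l
  ↑-upward (old _) (inS _ _) (in₁ _ _) u l = 𝒜₁.upward (E₁.Up-lift u) l
  ↑-upward (old _) (inS _ _) (in₂ _ _) u l = 𝒜₂.upward (E₂.Up-lift u) l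
  ↑-upward (old _) (in₁ _ _) (inS _ _) u l = E₁.Up-restrict (𝒜₁.upward u l)
  ↑-upward (old _) (in₁ _ _) (in₁ _ _) u l = 𝒜₁.upward u l
  ↑-upward (old _) (in₁ _ _) (in₂ _ _) u l = ₁₂.Up-transport u l
  ↑-upward (old _) (in₂ _ _) (inS _ _) u l = E₂.Up-restrict (𝒜₂.upward u l)
  ↑-upward (old _) (in₂ _ _) (in₁ _ _) u l = ₂₁.Up-transport u l
  ↑-upward (old _) (in₂ _ _) (in₂ _ _) u l = 𝒜₂.upward u l
  ↑-upward new₁    (inS _ _) (inS _ _) u l = 𝒜₁.upward u (E₁.Lt-lift l)
  ↑-upward new₁    (inS _ _) (in₁ _ _) u l = 𝒜₁.upward u l
  ↑-upward new₁    (inS _ _) (in₂ _ _) u l = ₁₂.UpVia-fromS u l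
  ↑-upward new₁    (in₁ _ _) (inS _ _) u l = 𝒜₁.upward u l
  ↑-upward new₁    (in₁ _ _) (in₁ _ _) u l = 𝒜₁.upward u l
  ↑-upward new₁    (in₁ _ _) (in₂ _ _) u l = ₁₂.Up-UpVia u l
  ↑-upward new₁    (in₂ _ _) (inS _ _) u l = ₁₂.UpVia-toS u l
  ↑-upward new₁    (in₂ _ _) (in₁ _ _) (_ , _ , _ , u , m) l = 𝒜₁.upward u (₂₁.LtVia-fromS m l)
  ↑-upward new₁    (in₂ _ _) (in₂ _ _) u l = ₁₂.UpVia-upward u l
  ↑-upward new₂    (inS _ _) (inS _ _) u l = 𝒜₂.upward u (E₂.Lt-lift l)
  ↑-upward new₂    (inS _ _) (in₁ _ _) u l = ₂₁.UpVia-fromS u l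
  ↑-upward new₂    (inS _ _) (in₂ _ _) u l = 𝒜₂.upward u l
  ↑-upward new₂    (in₁ _ _) (inS _ _) u l = ₂₁.UpVia-toS u l
  ↑-upward new₂    (in₁ _ _) (in₁ _ _) u l = ₂₁.UpVia-upward u l
  ↑-upward new₂    (in₁ _ _) (in₂ _ _) (_ , _ , _ , u , m) l = 𝒜₂.upward u (₁₂.LtVia-fromS m l)
  ↑-upward new₂    (in₂ _ _) (inS _ _) u l = 𝒜₂.upward u l
  ↑-upward new₂    (in₂ _ _) (in₁ _ _) u l = ₂₁.Up-UpVia u l
  ↑-upward new₂    (in₂ _ _) (in₂ _ _) u l = 𝒜₂.upward u l

  ↓-downward : ∀ a K L → a ↓ K → L ≺ K → a ↓ L
  ↓-downward _       fresh     _         _ ()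
  ↓-downward _       K         fresh     _ l = ⊥-elim (fresh-⊀ K l)
  ↓-downward (old _) (inS _ _) (inS _ _) d l = 𝒮.downward d l
  ↓-downward (old _) (inS _ _) (in₁ _ _) d l = 𝒜₁.downward (E₁.Down-lift d) l
  ↓-downward (old _) (inS _ _) (in₂ _ _) d l = 𝒜₂.downward (E₂.Down-lift d) l
  ↓-downward (old _) (in₁ _ _) (inS _ _) d l = E₁.Down-restrict (𝒜₁.downward d l)
  ↓-downward (old _) (in₁ _ _) (in₁ _ _) d l = 𝒜₁.downward d l
  ↓-downward (old _) (in₁ _ _) (in₂ _ _) d l = ₂₁.Down-transport d l
  ↓-downward (old _) (in₂ _ _) (inS _ _) d l = E₂.Down-restrict (𝒜₂.downward d l)
  ↓-downward (old _) (in₂ _ _) (in₁ _ _) d l = ₁₂.Down-transport d l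
  ↓-downward (old _) (in₂ _ _) (in₂ _ _) d l = 𝒜₂.downward d l
  ↓-downward new₁    (inS _ _) (inS _ _) d l = 𝒜₁.downward d (E₁.Lt-lift l)
  ↓-downward new₁    (inS _ _) (in₁ _ _) d l = 𝒜₁.downward d l
  ↓-downward new₁    (inS _ _) (in₂ _ _) d l = ₁₂.DownVia-fromS d l
  ↓-downward new₁    (in₁ _ _) (inS _ _) d l = 𝒜₁.downward d l
  ↓-downward new₁    (in₁ _ _) (in₁ _ _) d l = 𝒜₁.downward d l
  ↓-downward new₁    (in₁ _ _) (in₂ _ _) d (_ , _ , _ , l , m) = ₁₂.DownVia-fromS (𝒜₁.downward d m) l
  ↓-downward new₁    (in₂ _ _) (inS _ _) d l = ₁₂.DownVia-toS d l
  ↓-downward new₁    (in₂ _ _) (in₁ _ _) d l = ₁₂.DownVia-Down d l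
  ↓-downward new₁    (in₂ _ _) (in₂ _ _) d l = ₁₂.DownVia-downward d l
  ↓-downward new₂    (inS _ _) (inS _ _) d l = 𝒜₂.downward d (E₂.Lt-lift l)
  ↓-downward new₂    (inS _ _) (in₁ _ _) d l = ₂₁.DownVia-fromS d l
  ↓-downward new₂    (inS _ _) (in₂ _ _) d l = 𝒜₂.downward d l
  ↓-downward new₂    (in₁ _ _) (inS _ _) d l = ₂₁.DownVia-toS d l
  ↓-downward new₂    (in₁ _ _) (in₁ _ _) d l = ₂₁.DownVia-downward d l
  ↓-downward new₂    (in₁ _ _) (in₂ _ _) d l = ₂₁.DownVia-Down d l
  ↓-downward new₂    (in₂ _ _) (inS _ _) d l = 𝒜₂.downward d l
  ↓-downward new₂    (in₂ _ _) (in₁ _ _) d (_ , _ , _ , l , m) = ₂₁.DownVia-fromS (𝒜₂.downward d m) l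
  ↓-downward new₂    (in₂ _ _) (in₂ _ _) d l = 𝒜₂.downward d l

  ℳ : LabeledSwitchboard (Amalg S)
  ℳ = record
    { Lt          = λ a b c d → pair a b ≺ pair c d
    ; Up          = λ a b c → a ↑ pair b c
    ; Down        = λ a b c → a ↓ pair b c
    ; Lt-wf₁      = λ {a} {b} {c} {d} → distinct-pair a b ∘ ≺-distinctˡ (pair a b) (pair c d)
    ; Lt-wf₂      = λ {a} {b} {c} {d} → distinct-pair c d ∘ ≺-distinctʳ (pair a b) (pair c d)
    ; Up-wf       = λ {a} {b} {c} → distinct-pair b c ∘ ↑-distinct a (pair b c)
    ; Down-wf     = λ {a} {b} {c} → distinct-pair b c ∘ ↓-distinct a (pair b c)
    ; Lt-swap₁    = λ {a} {b} {c} {d} →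
                      subst (_≺ pair c d) (sym (pair-swap a b)) ∘ ≺-swapˡ (pair a b) (pair c d)
    ; Lt-swap₂    = λ {a} {b} {c} {d} →
                      subst (pair a b ≺_) (sym (pair-swap c d)) ∘ ≺-swapʳ (pair a b) (pair c d)
    ; Up-swap     = λ {a} {b} {c} → subst (a ↑_) (sym (pair-swap b c)) ∘ ↑-swap a (pair b c)
    ; Down-swap   = λ {a} {b} {c} → subst (a ↓_) (sym (pair-swap b c)) ∘ ↓-swap a (pair b c)
    ; Lt-irrefl   = λ {a} {b} → ≺-irrefl (pair a b)
    ; Lt-trans    = λ {a} {b} {c} {d} {e} {f} → ≺-trans (pair a b) (pair c d) (pair e f)
    ; switchboard = ≺-switchboard _ _ _
    ; tri         = λ {a} {b} {c} b≢c →
                      Sum.map₂ (Sum.map₁ (Equivalence.to (∈ₚ-pair b c)))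
                               (trichotomy a (pair b c) (pair-distinct b c b≢c))
    ; up-notin    = λ {a} {b} {c} u → ↑-∉ a (pair b c) u ∘ Equivalence.from (∈ₚ-pair b c)
    ; down-notin  = λ {a} {b} {c} d → ↓-∉ a (pair b c) d ∘ Equivalence.from (∈ₚ-pair b c)
    ; up-down     = λ {a} {b} {c} → ↑⇒¬↓ a (pair b c)
    ; upward      = λ {a} {b} {c} {b′} {c′} → ↑-upward a (pair b c) (pair b′ c′)
    ; downward    = λ {a} {b} {c} {b′} {c′} → ↓-downward a (pair b c) (pair b′ c′)
    }

  data Over (inᵢ : Maybe S → Maybe S → Pair) : Pair → Maybe S → Maybe S → Set where
    S-pair : ∀ s t → Over inᵢ (inS s t) (just s) (just t)
    A-pair : ∀ u v → Over inᵢ (inᵢ u v) u v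

  pair-ι₁ : ∀ a b → Over in₁ (pair (ι₁ a) (ι₁ b)) a b
  pair-ι₁ (just s) (just t) = S-pair s t
  pair-ι₁ (just _) nothing  = A-pair _ _
  pair-ι₁ nothing  (just _) = A-pair _ _
  pair-ι₁ nothing  nothing  = A-pair _ _

  pair-ι₂ : ∀ a b → Over in₂ (pair (ι₂ a) (ι₂ b)) a b
  pair-ι₂ (just s) (just t) = S-pair s t
  pair-ι₂ (just _) nothing  = A-pair _ _
  pair-ι₂ nothing  (just _) = A-pair _ _
  pair-ι₂ nothing  nothing  = A-pair _ _

  ≺-over₁ : ∀ {K L a b c d} → Over in₁ K a b → Over in₁ L c d → 𝒜₁.Lt a b c d ⇔ K ≺ L
  ≺-over₁ (S-pair s t) (S-pair u v) = ⇔.sym (IsEmbedding.Lt-iff 𝒮⊆𝒜₁ s t u v)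
  ≺-over₁ (S-pair _ _) (A-pair _ _) = ⇔.refl
  ≺-over₁ (A-pair _ _) (S-pair _ _) = ⇔.refl
  ≺-over₁ (A-pair _ _) (A-pair _ _) = ⇔.refl

  ≺-over₂ : ∀ {K L a b c d} → Over in₂ K a b → Over in₂ L c d → 𝒜₂.Lt a b c d ⇔ K ≺ L
  ≺-over₂ (S-pair s t) (S-pair u v) = ⇔.sym (IsEmbedding.Lt-iff 𝒮⊆𝒜₂ s t u v)
  ≺-over₂ (S-pair _ _) (A-pair _ _) = ⇔.refl
  ≺-over₂ (A-pair _ _) (S-pair _ _) = ⇔.refl
  ≺-over₂ (A-pair _ _) (A-pair _ _) = ⇔.refl

  ↑-over₁ : ∀ a {K b c} → Over in₁ K b c → 𝒜₁.Up a b c ⇔ ι₁ a ↑ K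
  ↑-over₁ (just s) (S-pair t u) = ⇔.sym (IsEmbedding.Up-iff 𝒮⊆𝒜₁ s t u)
  ↑-over₁ nothing  (S-pair _ _) = ⇔.refl
  ↑-over₁ (just _) (A-pair _ _) = ⇔.refl
  ↑-over₁ nothing  (A-pair _ _) = ⇔.refl

  ↑-over₂ : ∀ a {K b c} → Over in₂ K b c → 𝒜₂.Up a b c ⇔ ι₂ a ↑ K
  ↑-over₂ (just s) (S-pair t u) = ⇔.sym (IsEmbedding.Up-iff 𝒮⊆𝒜₂ s t u)
  ↑-over₂ nothing  (S-pair _ _) = ⇔.refl
  ↑-over₂ (just _) (A-pair _ _) = ⇔.refl
  ↑-over₂ nothing  (A-pair _ _) = ⇔.refl

  ↓-over₁ : ∀ a {K b c} → Over in₁ K b c → 𝒜₁.Down a b c ⇔ ι₁ a ↓ K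
  ↓-over₁ (just s) (S-pair t u) = ⇔.sym (IsEmbedding.Down-iff 𝒮⊆𝒜₁ s t u)
  ↓-over₁ nothing  (S-pair _ _) = ⇔.refl
  ↓-over₁ (just _) (A-pair _ _) = ⇔.refl
  ↓-over₁ nothing  (A-pair _ _) = ⇔.refl

  ↓-over₂ : ∀ a {K b c} → Over in₂ K b c → 𝒜₂.Down a b c ⇔ ι₂ a ↓ K
  ↓-over₂ (just s) (S-pair t u) = ⇔.sym (IsEmbedding.Down-iff 𝒮⊆𝒜₂ s t u)
  ↓-over₂ nothing  (S-pair _ _) = ⇔.refl
  ↓-over₂ (just _) (A-pair _ _) = ⇔.refl
  ↓-over₂ nothing  (A-pair _ _) = ⇔.refl

  ι₁-embedding : IsEmbedding 𝒜₁ ℳ ι₁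
  ι₁-embedding = record
    { injective = ι₁-injective
    ; Lt-iff    = λ a b c d → ≺-over₁ (pair-ι₁ a b) (pair-ι₁ c d)
    ; Up-iff    = λ a b c → ↑-over₁ a (pair-ι₁ b c)
    ; Down-iff  = λ a b c → ↓-over₁ a (pair-ι₁ b c)
    }

  ι₂-embedding : IsEmbedding 𝒜₂ ℳ ι₂
  ι₂-embedding = record
    { injective = ι₂-injective
    ; Lt-iff    = λ a b c d → ≺-over₂ (pair-ι₂ a b) (pair-ι₂ c d)
    ; Up-iff    = λ a b c → ↑-over₂ a (pair-ι₂ b c)
    ; Down-iff  = λ a b c → ↓-over₂ a (pair-ι₂ b c)
    }

  freely-amalgamated : FreelyAmalgamated ℳ
  freely-amalgamated = record
    { free-i   = λ _ _ → ⇔.refl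
    ; free-ii  = λ _ _ → ⇔.refl
    ; free-iii = λ c d → fresh-⊀ (pair c d) , λ ()
    ; free-iv  = λ _ → tt
    ; free-v   = λ _ → ⇔.refl
    ; free-vi  = λ _ → ⇔.refl
    }

lemma4p16 : ExcludedMiddle 0ℓ →
    {S : Set} (𝒮 : LabeledSwitchboard S)
    (𝒜₁ : LabeledSwitchboard (Maybe S)) (𝒜₂ : LabeledSwitchboard (Maybe S)) →
    IsEmbedding 𝒮 𝒜₁ just → IsEmbedding 𝒮 𝒜₂ just →
    Σ (LabeledSwitchboard (Amalg S)) λ ℳ →
      IsEmbedding 𝒜₁ ℳ ι₁ × IsEmbedding 𝒜₂ ℳ ι₂ × FreelyAmalgamated ℳ
lemma4p16 em _ _ _ 𝒮⊆𝒜₁ 𝒮⊆𝒜₂ = ℳ , ι₁-embedding , ι₂-embedding , freely-amalgamated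
  where open FreeAmalgam em 𝒮⊆𝒜₁ 𝒮⊆𝒜₂
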